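{- Let $G$ be a finite abelian group of order $n\ge 2$, let $l$ be the order of its subgroup of elements of order at most $2$, and let $m$ be a positive integer with $m\le n$. Then $G$ contains a subset of size $m$ whose elements sum to $0$, except in the following cases (in which no such subset exists): (i) $G$ is isomorphic to an elementary abelian $2$-group and $m\in\{2,n-2\}$; or (ii) $l=2$ and $m=n$.
   Context: $G$ is written additively. -}

module Defs where

open import Level using (Level)
open import Algebra.Bundles using (AbelianGroup)
open import Data.Nat using (ℕ; zero; suc)
open import Data.Fin using (Fin; zero; suc)
open import Data.Fin.Subset using (Subset; inside; outside; ∣_∣)
open import Data.Vec using (Vec; []; _∷_; tabulate)
open import Data.Product using (∃)
open import Relation.Binary.PropositionalEquality using (_≡_)
open import Relation.Binary.Definitions using (Decidable)
open import Relation.Nullary using (does)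

module _ {c ℓ : Level} (G : AbelianGroup c ℓ) where
  open AbelianGroup G

  record IsFiniteOfOrder (n : ℕ) : Set (c Level.⊔ ℓ) where
    field
      enum       : Fin n → Carrier
      injective  : ∀ i j → enum i ≈ enum j → i ≡ j
      surjective : ∀ x → ∃ λ i → enum i ≈ x

  subsetSum : ∀ {k} → (Fin k → Carrier) → Subset k → Carrier
  subsetSum f [] = ε
  subsetSum f (inside ∷ s) = f zero ∙ subsetSum (λ i → f (suc i)) s
  subsetSum f (outside ∷ s) = subsetSum (λ i → f (suc i)) s

  IsElementaryAbelian2 : Set (c Level.⊔ ℓ)
  IsElementaryAbelian2 = ∀ x → x ∙ x ≈ ε

  twoTorsion : ∀ {n} → Decidable _≈_ → IsFiniteOfOrder n → Subset n
  twoTorsion _≟_ fin = tabulate (λ i → does ((enum i ∙ enum i) ≟ ε))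
    where open IsFiniteOfOrder fin

  twoTorsionOrder : ∀ {n} → Decidable _≈_ → IsFiniteOfOrder n → ℕ
  twoTorsionOrder dec fin = ∣ twoTorsion dec fin ∣

-- Let T₂ = {x : 2x = 0} and N = G ∖ T₂. Negation splits N into pairs {x, -x}, so ∑ N = 0, the
-- sum of all of G is ∑ T₂, and pairs from N (plus 0) give zero-sum sets of every size up to
-- ∣N∣ + 1. For each a ≠ 0 in T₂, translation by a splits T₂ into pairs {x, x + a}, so ∑ T₂ = k·a
-- with 2k = ∣T₂∣; comparing two values of a shows ∑ T₂ = 0 once ∣T₂∣ ≥ 3, while ∣T₂∣ = 2 makes it
-- nonzero. When ∑ G = 0, complements handle n - m ≤ ∣N∣ + 1. If m and n - m both exceed ∣N∣ + 1
-- then ∣T₂∣ > ∣N∣, which forces N = ∅ since T₂ + x ⊆ N for x ∈ N: G is an elementary abelian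
-- 2-group, where a set of size m - 2 with nonzero sum s is completed by a pair {a, a + s}.
-- Conversely, in such a group no two distinct elements sum to 0.

module Submission where

open import Defs
import Level
open import Algebra.Bundles using (AbelianGroup)
open import Data.Nat using (ℕ; zero; suc; _+_; _*_; _≤_; _<_; _∸_; z≤n; s≤s)
import Data.Nat.Properties as ℕ
open import Data.Fin using (Fin; zero; suc)
open import Data.Fin.Properties using (suc-injective; injective⇒≤)
open import Data.Fin.Subset
  using (Subset; ∣_∣; inside; outside; _∈_; _∉_; _⊆_; ∁; ⊤; ⊥; _∪_; Nonempty)
open import Data.Fin.Subset.Properties
  using ( ∉⊥; ⊥⊆; ∣⊥∣≡0; p⊆q⇒∣p∣≤∣q∣; nonempty?; Empty-unique; x∈∁p⇒x∉p; x∉p⇒x∈∁p; x∈p∪q⁺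
        ; ∣∁p∣≡n∸∣p∣; ∣p∣≤n; ∣p∣≡n⇒p≡⊤; _∈?_)
open import Data.Vec using ([]; _∷_; here; there; tabulate; lookup)
open import Data.Vec.Properties using ([]=⇒lookup; lookup⇒[]=; lookup∘tabulate)
open import Data.Product using (Σ; _×_; _,_; proj₁; proj₂; ∃)
open import Data.Sum using (_⊎_; inj₁; inj₂)
open import Function using (_∘_)
open import Function.Bundles using (_⇔_; mk⇔)
open import Relation.Nullary using (¬_; Dec; yes; no; does; contradiction)
open import Relation.Nullary.Decidable using (dec-true)
open import Relation.Binary.Definitions using (Decidable)
open import Relation.Binary.PropositionalEquality as ≡ using (_≡_; _≢_)

private variable
  k n : ℕ

even⊎odd : ∀ m → ∃ λ j → m ≡ 2 * j ⊎ m ≡ suc (2 * j)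
even⊎odd zero = 0 , inj₁ ≡.refl
even⊎odd (suc m) with even⊎odd m
... | j , inj₁ m≡2j   = j , inj₂ (≡.cong suc m≡2j)
... | j , inj₂ m≡1+2j = suc j , inj₁ (≡.trans (≡.cong suc m≡1+2j) (≡.sym (ℕ.*-suc 2 j)))

2*j≤1+2*k⇒j≤k : ∀ j k → 2 * j ≤ suc (2 * k) → j ≤ k
2*j≤1+2*k⇒j≤k j k 2j≤1+2k =
  ℕ.≤-pred (ℕ.*-cancelˡ-< 2 j (suc k) (ℕ.≤-trans (s≤s 2j≤1+2k) (ℕ.≤-reflexive (≡.sym (ℕ.*-suc 2 k)))))

m≤n∸m⇒m+m≤n : ∀ {m n} → m ≤ n ∸ m → m + m ≤ n
m≤n∸m⇒m+m≤n {m} {n} m≤n∸m =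
  ℕ.≤-trans (ℕ.+-monoʳ-≤ m m≤n∸m) (ℕ.≤-reflexive (ℕ.m+[n∸m]≡n (ℕ.≤-trans m≤n∸m (ℕ.m∸n≤m n m))))

a<m∧b<n∸m⇒a+b<n : ∀ {a b m n} → m ≤ n → a < m → b < n ∸ m → a + b < n
a<m∧b<n∸m⇒a+b<n m≤n a<m b<n-m = ℕ.<-≤-trans (ℕ.+-mono-< a<m b<n-m) (ℕ.≤-reflexive (ℕ.m+[n∸m]≡n m≤n))

1≤n∸2⇒3≤n : ∀ n → 1 ≤ n ∸ 2 → 3 ≤ n
1≤n∸2⇒3≤n (suc (suc (suc _))) _ = s≤s (s≤s (s≤s z≤n))

delete insert : Fin n → Subset n → Subset n
delete zero    (_ ∷ p) = outside ∷ p
delete (suc i) (x ∷ p) = x ∷ delete i p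
insert zero    (_ ∷ p) = inside ∷ p
insert (suc i) (x ∷ p) = x ∷ insert i p

∣delete∣ : ∀ i (p : Subset n) → i ∈ p → ∣ p ∣ ≡ suc ∣ delete i p ∣
∣delete∣ zero    (inside  ∷ p) here       = ≡.refl
∣delete∣ (suc i) (inside  ∷ p) (there i∈p) = ≡.cong suc (∣delete∣ i p i∈p)
∣delete∣ (suc i) (outside ∷ p) (there i∈p) = ∣delete∣ i p i∈p

∣insert∣ : ∀ i (p : Subset n) → i ∉ p → ∣ insert i p ∣ ≡ suc ∣ p ∣
∣insert∣ zero    (inside  ∷ p) i∉p = contradiction here i∉p
∣insert∣ zero    (outside ∷ p) i∉p = ≡.refl
∣insert∣ (suc i) (inside  ∷ p) i∉p = ≡.cong suc (∣insert∣ i p (i∉p ∘ there))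
∣insert∣ (suc i) (outside ∷ p) i∉p = ∣insert∣ i p (i∉p ∘ there)

∈delete⁻ : ∀ i (p : Subset n) {j} → j ∈ delete i p → j ∈ p × j ≢ i
∈delete⁻ zero    (_ ∷ p) {suc j} (there j∈) = there j∈ , λ ()
∈delete⁻ (suc i) (_ ∷ p) {zero}  here       = here , λ ()
∈delete⁻ (suc i) (_ ∷ p) {suc j} (there j∈) =
  let j∈p , j≢i = ∈delete⁻ i p j∈ in there j∈p , j≢i ∘ suc-injective

∈delete⁺ : ∀ i (p : Subset n) {j} → j ∈ p → j ≢ i → j ∈ delete i p
∈delete⁺ zero    (_ ∷ p) here        j≢i = contradiction ≡.refl j≢i
∈delete⁺ zero    (_ ∷ p) (there j∈p) j≢i = there j∈p
∈delete⁺ (suc i) (_ ∷ p) here        j≢i = here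
∈delete⁺ (suc i) (_ ∷ p) (there j∈p) j≢i = there (∈delete⁺ i p j∈p (j≢i ∘ ≡.cong suc))

∈insert⁻ : ∀ i (p : Subset n) {j} → j ∈ insert i p → j ≡ i ⊎ j ∈ p
∈insert⁻ zero    (_ ∷ p) here       = inj₁ ≡.refl
∈insert⁻ zero    (_ ∷ p) (there j∈) = inj₂ (there j∈)
∈insert⁻ (suc i) (_ ∷ p) here       = inj₂ here
∈insert⁻ (suc i) (_ ∷ p) (there j∈) with ∈insert⁻ i p j∈
... | inj₁ j≡i = inj₁ (≡.cong suc j≡i)
... | inj₂ j∈p = inj₂ (there j∈p)

∉insert : ∀ i (p : Subset n) {j} → j ≢ i → j ∉ p → j ∉ insert i p
∉insert i p j≢i j∉p j∈ with ∈insert⁻ i p j∈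
... | inj₁ j≡i = j≢i j≡i
... | inj₂ j∈p = j∉p j∈p

insert-⊆ : ∀ i (p : Subset n) {q} → i ∈ q → p ⊆ q → insert i p ⊆ q
insert-⊆ i p i∈q p⊆q j∈ with ∈insert⁻ i p j∈
... | inj₁ ≡.refl = i∈q
... | inj₂ j∈p  = p⊆q j∈p

0<∣p∣⇒Nonempty : (p : Subset n) → 0 < ∣ p ∣ → Nonempty p
0<∣p∣⇒Nonempty (inside  ∷ p) _ = zero , here
0<∣p∣⇒Nonempty (outside ∷ p) 0<∣p∣ =
  let i , i∈p = 0<∣p∣⇒Nonempty p 0<∣p∣ in suc i , there i∈p

∣p∣<n⇒∃∉ : (p : Subset n) → ∣ p ∣ < n → ∃ (_∉ p)
∣p∣<n⇒∃∉ (outside ∷ p) _ = zero , λ ()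
∣p∣<n⇒∃∉ (inside  ∷ p) (s≤s ∣p∣<n) =
  let i , i∉p = ∣p∣<n⇒∃∉ p ∣p∣<n in suc i , λ { (there i∈p) → i∉p i∈p }

∣p∣≡0⇒p≡⊥ : (p : Subset n) → ∣ p ∣ ≡ 0 → p ≡ ⊥
∣p∣≡0⇒p≡⊥ []            _     = ≡.refl
∣p∣≡0⇒p≡⊥ (outside ∷ p) ∣p∣≡0 = ≡.cong (outside ∷_) (∣p∣≡0⇒p≡⊥ p ∣p∣≡0)

∣p∪q∣≤∣p∣+∣q∣ : (p q : Subset n) → ∣ p ∪ q ∣ ≤ ∣ p ∣ + ∣ q ∣
∣p∪q∣≤∣p∣+∣q∣ []            []            = z≤n
∣p∪q∣≤∣p∣+∣q∣ (inside  ∷ p) (inside  ∷ q) =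
  s≤s (ℕ.≤-trans (∣p∪q∣≤∣p∣+∣q∣ p q) (ℕ.+-monoʳ-≤ ∣ p ∣ (ℕ.n≤1+n ∣ q ∣)))
∣p∪q∣≤∣p∣+∣q∣ (inside  ∷ p) (outside ∷ q) = s≤s (∣p∪q∣≤∣p∣+∣q∣ p q)
∣p∪q∣≤∣p∣+∣q∣ (outside ∷ p) (inside  ∷ q) =
  ℕ.≤-trans (s≤s (∣p∪q∣≤∣p∣+∣q∣ p q)) (ℕ.≤-reflexive (≡.sym (ℕ.+-suc ∣ p ∣ ∣ q ∣)))
∣p∪q∣≤∣p∣+∣q∣ (outside ∷ p) (outside ∷ q) = ∣p∪q∣≤∣p∣+∣q∣ p q

subsetOfSize : ∀ k → k ≤ n → ∃ λ (p : Subset n) → ∣ p ∣ ≡ k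
subsetOfSize {n}     zero    _         = ⊥ , ∣⊥∣≡0 n
subsetOfSize {suc n} (suc k) (s≤s k≤n) =
  let p , ∣p∣≡k = subsetOfSize k k≤n in inside ∷ p , ≡.cong suc ∣p∣≡k

twoOthers : ∀ (p : Subset n) {i} → i ∈ p → 3 ≤ ∣ p ∣ →
            ∃ λ a → ∃ λ b → a ∈ p × b ∈ p × a ≢ i × b ≢ i × b ≢ a
twoOthers p {i} i∈p 3≤∣p∣ =
  let 2≤∣p-i∣       = ℕ.≤-pred (≡.subst (3 ≤_) (∣delete∣ i p i∈p) 3≤∣p∣)
      a , a∈p-i     = 0<∣p∣⇒Nonempty (delete i p) (ℕ.≤-trans (s≤s z≤n) 2≤∣p-i∣)
      1≤∣p-i-a∣     = ℕ.≤-pred (≡.subst (2 ≤_) (∣delete∣ a (delete i p) a∈p-i) 2≤∣p-i∣)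
      b , b∈p-i-a   = 0<∣p∣⇒Nonempty (delete a (delete i p)) 1≤∣p-i-a∣
      a∈p , a≢i     = ∈delete⁻ i p a∈p-i
      b∈p-i , b≢a   = ∈delete⁻ a (delete i p) b∈p-i-a
      b∈p , b≢i     = ∈delete⁻ i p b∈p-i
  in a , b , a∈p , b∈p , a≢i , b≢i , b≢a

rank : (p : Subset n) {i : Fin n} → i ∈ p → Fin ∣ p ∣
rank (inside  ∷ p) here        = zero
rank (inside  ∷ p) (there i∈p) = suc (rank p i∈p)
rank (outside ∷ p) (there i∈p) = rank p i∈p

rank-injective : (p : Subset n) {i j : Fin n} (i∈p : i ∈ p) (j∈p : j ∈ p) → rank p i∈p ≡ rank p j∈p → i ≡ j
rank-injective (inside  ∷ p) here        here        _  = ≡.refl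
rank-injective (inside  ∷ p) (there i∈p) (there j∈p) eq = ≡.cong suc (rank-injective p i∈p j∈p (suc-injective eq))
rank-injective (outside ∷ p) (there i∈p) (there j∈p) eq = ≡.cong suc (rank-injective p i∈p j∈p eq)

select : (p : Subset n) → Fin ∣ p ∣ → ∃ (_∈ p)
select (inside  ∷ p) zero    = zero , here
select (inside  ∷ p) (suc r) = let i , i∈p = select p r in suc i , there i∈p
select (outside ∷ p) r       = let i , i∈p = select p r in suc i , there i∈p

select-injective : (p : Subset n) (r s : Fin ∣ p ∣) → proj₁ (select p r) ≡ proj₁ (select p s) → r ≡ s
select-injective (inside  ∷ p) zero    zero    _  = ≡.refl
select-injective (inside  ∷ p) (suc r) (suc s) eq = ≡.cong suc (select-injective p r s (suc-injective eq))
select-injective (outside ∷ p) r       s       eq = select-injective p r s (suc-injective eq)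

injection⇒∣p∣≤∣q∣ : ∀ {m} {p : Subset m} {q : Subset n} (g : Fin m → Fin n) →
                    (∀ {i j} → g i ≡ g j → i ≡ j) → (∀ {i} → i ∈ p → g i ∈ q) → ∣ p ∣ ≤ ∣ q ∣
injection⇒∣p∣≤∣q∣ {p = p} {q} g g-injective g-maps = injective⇒≤ h-injective
  where
  h : Fin ∣ p ∣ → Fin ∣ q ∣
  h r = rank q (g-maps (proj₂ (select p r)))
  h-injective : ∀ {r s} → h r ≡ h s → r ≡ s
  h-injective {r} {s} eq = select-injective p r s (g-injective (rank-injective q _ _ eq))

preimage : ∀ {m} → (Fin m → Fin n) → Subset n → Subset m
preimage g q = tabulate (lookup q ∘ g)

∈preimage⁻ : ∀ {m} (g : Fin m → Fin n) q {i} → i ∈ preimage g q → g i ∈ q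
∈preimage⁻ g q {i} i∈ = lookup⇒[]= (g i) q (≡.trans (≡.sym (lookup∘tabulate _ i)) ([]=⇒lookup i∈))

∈preimage⁺ : ∀ {m} (g : Fin m → Fin n) q {i} → g i ∈ q → i ∈ preimage g q
∈preimage⁺ g q {i} gi∈q = lookup⇒[]= i (preimage g q) (≡.trans (lookup∘tabulate _ i) ([]=⇒lookup gi∈q))

∣p∪preimage∣≤∣p∣+∣p∣ : (g : Fin n → Fin n) → (∀ {i j} → g i ≡ g j → i ≡ j) →
                       ∀ p → ∣ p ∪ preimage g p ∣ ≤ ∣ p ∣ + ∣ p ∣
∣p∪preimage∣≤∣p∣+∣p∣ g g-injective p =
  ℕ.≤-trans (∣p∪q∣≤∣p∣+∣q∣ p (preimage g p)) (ℕ.+-monoʳ-≤ ∣ p ∣ (injection⇒∣p∣≤∣q∣ g g-injective (∈preimage⁻ g p)))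

module SubsetSums {g ℓ} (G : AbelianGroup g ℓ) where
  open AbelianGroup G
  open import Algebra.Properties.CommutativeSemigroup commutativeSemigroup using (x∙yz≈y∙xz)
  open import Algebra.Properties.Monoid.Mult monoid public using () renaming (_×_ to _·_)
  open import Relation.Binary.Reasoning.Setoid setoid

  ∑ : (Fin k → Carrier) → Subset k → Carrier
  ∑ = subsetSum G

  ∑-delete : ∀ (f : Fin n → Carrier) i p → i ∈ p → ∑ f p ≈ f i ∙ ∑ f (delete i p)
  ∑-delete f zero    (inside  ∷ p) here        = refl
  ∑-delete f (suc i) (inside  ∷ p) (there i∈p) = trans (∙-congˡ (∑-delete (f ∘ suc) i p i∈p)) (x∙yz≈y∙xz _ _ _)
  ∑-delete f (suc i) (outside ∷ p) (there i∈p) = ∑-delete (f ∘ suc) i p i∈p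

  ∑-insert : ∀ (f : Fin n → Carrier) i p → i ∉ p → ∑ f (insert i p) ≈ f i ∙ ∑ f p
  ∑-insert f zero    (inside  ∷ p) i∉p = contradiction here i∉p
  ∑-insert f zero    (outside ∷ p) i∉p = refl
  ∑-insert f (suc i) (inside  ∷ p) i∉p = trans (∙-congˡ (∑-insert (f ∘ suc) i p (i∉p ∘ there))) (x∙yz≈y∙xz _ _ _)
  ∑-insert f (suc i) (outside ∷ p) i∉p = ∑-insert (f ∘ suc) i p (i∉p ∘ there)

  ∑-⊥ : ∀ (f : Fin n → Carrier) → ∑ f ⊥ ≈ ε
  ∑-⊥ {zero}  f = refl
  ∑-⊥ {suc n} f = ∑-⊥ (f ∘ suc)

  ∑-empty : ∀ (f : Fin n → Carrier) p → ∣ p ∣ ≡ 0 → ∑ f p ≈ ε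
  ∑-empty f p ∣p∣≡0 rewrite ∣p∣≡0⇒p≡⊥ p ∣p∣≡0 = ∑-⊥ f

  ∑-∁ : ∀ (f : Fin n → Carrier) p → ∑ f p ∙ ∑ f (∁ p) ≈ ∑ f ⊤
  ∑-∁ f []            = identityˡ ε
  ∑-∁ f (inside  ∷ p) = trans (assoc _ _ _) (∙-congˡ (∑-∁ (f ∘ suc) p))
  ∑-∁ f (outside ∷ p) = trans (x∙yz≈y∙xz _ _ _) (∙-congˡ (∑-∁ (f ∘ suc) p))

  ∑-delete₂ : ∀ (f : Fin n → Carrier) i j p → i ∈ p → j ∈ delete i p →
              ∑ f p ≈ (f i ∙ f j) ∙ ∑ f (delete j (delete i p))
  ∑-delete₂ f i j p i∈p j∈p-i = begin
    ∑ f p                                    ≈⟨ ∑-delete f i p i∈p ⟩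
    f i ∙ ∑ f (delete i p)                   ≈⟨ ∙-congˡ (∑-delete f j (delete i p) j∈p-i) ⟩
    f i ∙ (f j ∙ ∑ f (delete j (delete i p))) ≈⟨ sym (assoc _ _ _) ⟩
    (f i ∙ f j) ∙ ∑ f (delete j (delete i p)) ∎

  ∑-insert₂ : ∀ (f : Fin n → Carrier) i j p → j ∉ p → i ∉ insert j p →
              ∑ f (insert i (insert j p)) ≈ (f i ∙ f j) ∙ ∑ f p
  ∑-insert₂ f i j p j∉p i∉j∷p = begin
    ∑ f (insert i (insert j p)) ≈⟨ ∑-insert f i (insert j p) i∉j∷p ⟩
    f i ∙ ∑ f (insert j p)      ≈⟨ ∙-congˡ (∑-insert f j p j∉p) ⟩
    f i ∙ (f j ∙ ∑ f p)         ≈⟨ sym (assoc _ _ _) ⟩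
    (f i ∙ f j) ∙ ∑ f p         ∎

  ∑-of-size-2 : ∀ (f : Fin n → Carrier) p {i} → ∣ p ∣ ≡ 2 → i ∈ p → ∃ λ j → j ≢ i × ∑ f p ≈ f i ∙ f j
  ∑-of-size-2 f p {i} ∣p∣≡2 i∈p = i′ , proj₂ (∈delete⁻ i p i′∈p-i) , (begin
    ∑ f p                                       ≈⟨ ∑-delete₂ f i i′ p i∈p i′∈p-i ⟩
    (f i ∙ f i′) ∙ ∑ f (delete i′ (delete i p)) ≈⟨ ∙-congˡ (∑-empty f (delete i′ (delete i p)) ∣p-i-i′∣≡0) ⟩
    (f i ∙ f i′) ∙ ε                            ≈⟨ identityʳ _ ⟩
    f i ∙ f i′                                  ∎)
    where
    ∣p-i∣≡1 : ∣ delete i p ∣ ≡ 1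
    ∣p-i∣≡1 = ℕ.suc-injective (≡.trans (≡.sym (∣delete∣ i p i∈p)) ∣p∣≡2)
    other : Nonempty (delete i p)
    other = 0<∣p∣⇒Nonempty (delete i p) (≡.subst (0 <_) (≡.sym ∣p-i∣≡1) (s≤s z≤n))
    i′ = proj₁ other
    i′∈p-i = proj₂ other
    ∣p-i-i′∣≡0 : ∣ delete i′ (delete i p) ∣ ≡ 0
    ∣p-i-i′∣≡0 = ℕ.suc-injective (≡.trans (≡.sym (∣delete∣ i′ (delete i p) i′∈p-i)) ∣p-i∣≡1)

  ·-twoTorsion : ∀ k → (∀ {x} → x ∙ x ≈ ε → k · x ≈ ε) ⊎ (∀ {x} → x ∙ x ≈ ε → k · x ≈ x)
  ·-twoTorsion zero    = inj₁ λ _ → refl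
  ·-twoTorsion (suc k) with ·-twoTorsion k
  ... | inj₁ k·x≈ε = inj₂ λ x∙x≈ε → trans (∙-congˡ (k·x≈ε x∙x≈ε)) (identityʳ _)
  ... | inj₂ k·x≈x = inj₁ λ x∙x≈ε → trans (∙-congˡ (k·x≈x x∙x≈ε)) x∙x≈ε

  ·-ε : ∀ k → k · ε ≈ ε
  ·-ε k with ·-twoTorsion k
  ... | inj₁ k·x≈ε = k·x≈ε (identityˡ ε)
  ... | inj₂ k·x≈x = k·x≈x (identityˡ ε)

  module Pairing {n} (f : Fin n → Carrier) (σ : Fin n → Fin n) (σ-involutive : ∀ i → σ (σ i) ≡ i)
                 (a : Carrier) where

    Paired : Subset n → Set ℓ
    Paired S = ∀ {i} → i ∈ S → σ i ∈ S × σ i ≢ i × f i ∙ f (σ i) ≈ a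

    σ-injective : ∀ {i j} → σ i ≡ σ j → i ≡ j
    σ-injective {i = i} {j} σi≡σj = ≡.trans (≡.sym (σ-involutive i)) (≡.trans (≡.cong σ σi≡σj) (σ-involutive j))

    deletePair insertPair : Fin n → Subset n → Subset n
    deletePair i S = delete (σ i) (delete i S)
    insertPair i T = insert i (insert (σ i) T)

    ∈deletePair⁻ : ∀ i S {j} → j ∈ deletePair i S → j ∈ S × j ≢ i × j ≢ σ i
    ∈deletePair⁻ i S j∈ =
      let j∈S-i , j≢σi = ∈delete⁻ (σ i) (delete i S) j∈
          j∈S , j≢i = ∈delete⁻ i S j∈S-i
      in j∈S , j≢i , j≢σi

    module _ {S} (S-paired : Paired S) {i} (i∈S : i ∈ S) where

      σi∈S = proj₁ (S-paired i∈S)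
      σi≢i = proj₁ (proj₂ (S-paired i∈S))
      fi∙fσi≈a = proj₂ (proj₂ (S-paired i∈S))

      σi∈S-i : σ i ∈ delete i S
      σi∈S-i = ∈delete⁺ i S σi∈S σi≢i

      ∣deletePair∣ : ∣ S ∣ ≡ 2 + ∣ deletePair i S ∣
      ∣deletePair∣ = ≡.trans (∣delete∣ i S i∈S) (≡.cong suc (∣delete∣ (σ i) (delete i S) σi∈S-i))

      ∑-deletePair : ∑ f S ≈ a ∙ ∑ f (deletePair i S)
      ∑-deletePair = trans (∑-delete₂ f i (σ i) S i∈S σi∈S-i) (∙-congʳ fi∙fσi≈a)

      deletePair-paired : Paired (deletePair i S)
      deletePair-paired {j} j∈ with ∈deletePair⁻ i S j∈
      ... | j∈S , j≢i , j≢σi =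
        let σj∈S , σj≢j , fj∙fσj≈a = S-paired j∈S
            σj≢i : σ j ≢ i
            σj≢i σj≡i = j≢σi (≡.trans (≡.sym (σ-involutive j)) (≡.cong σ σj≡i))
        in ∈delete⁺ (σ i) (delete i S) (∈delete⁺ i S σj∈S σj≢i) (j≢i ∘ σ-injective) , σj≢j , fj∙fσj≈a

      module _ {T} (T⊆S′ : T ⊆ deletePair i S) where

        σi∉T : σ i ∉ T
        σi∉T σi∈T = proj₂ (proj₂ (∈deletePair⁻ i S (T⊆S′ σi∈T))) ≡.refl

        i∉σi∷T : i ∉ insert (σ i) T
        i∉σi∷T = ∉insert (σ i) T (σi≢i ∘ ≡.sym) (λ i∈T → proj₁ (proj₂ (∈deletePair⁻ i S (T⊆S′ i∈T))) ≡.refl)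

        insertPair-⊆ : insertPair i T ⊆ S
        insertPair-⊆ = insert-⊆ i (insert (σ i) T) i∈S
                         (insert-⊆ (σ i) T σi∈S (λ j∈T → proj₁ (∈deletePair⁻ i S (T⊆S′ j∈T))))

        ∣insertPair∣ : ∣ insertPair i T ∣ ≡ 2 + ∣ T ∣
        ∣insertPair∣ = ≡.trans (∣insert∣ i (insert (σ i) T) i∉σi∷T) (≡.cong suc (∣insert∣ (σ i) T σi∉T))

        ∑-insertPair : ∑ f (insertPair i T) ≈ a ∙ ∑ f T
        ∑-insertPair = trans (∑-insert₂ f i (σ i) T σi∉T i∉σi∷T) (∙-congʳ fi∙fσi≈a)

    paired-size-sum : ∀ {S} → Paired S → ∃ λ k → ∣ S ∣ ≡ 2 * k × ∑ f S ≈ k · a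
    paired-size-sum {S} = go n (∣p∣≤n S)
      where
      go : ∀ s {S} → ∣ S ∣ ≤ s → Paired S → ∃ λ k → ∣ S ∣ ≡ 2 * k × ∑ f S ≈ k · a
      go zero    {S} ∣S∣≤0 _ = 0 , ℕ.n≤0⇒n≡0 ∣S∣≤0 , ∑-empty f S (ℕ.n≤0⇒n≡0 ∣S∣≤0)
      go (suc s) {S} ∣S∣≤1+s S-paired with nonempty? S
      ... | no S-empty rewrite Empty-unique S-empty = 0 , ∣⊥∣≡0 n , ∑-⊥ f
      ... | yes (i , i∈S) =
        let ∣S∣≡2+∣S′∣ = ∣deletePair∣ S-paired i∈S
            ∣S′∣≤s = ℕ.<⇒≤ (ℕ.≤-pred (≡.subst (_≤ suc s) ∣S∣≡2+∣S′∣ ∣S∣≤1+s))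
            k , ∣S′∣≡2k , ∑S′≈k·a = go s ∣S′∣≤s (deletePair-paired S-paired i∈S)
        in suc k ,
           ≡.trans ∣S∣≡2+∣S′∣ (≡.trans (≡.cong (2 +_) ∣S′∣≡2k) (≡.sym (ℕ.*-suc 2 k))) ,
           trans (∑-deletePair S-paired i∈S) (∙-congˡ ∑S′≈k·a)

    paired-subset : ∀ k {S} → Paired S → 2 * k ≤ ∣ S ∣ →
                    ∃ λ T → T ⊆ S × ∣ T ∣ ≡ 2 * k × ∑ f T ≈ k · a
    paired-subset zero    _ _ = ⊥ , ⊥⊆ , ∣⊥∣≡0 n , ∑-⊥ f
    paired-subset (suc k) {S} S-paired 2[1+k]≤∣S∣
      with 0<∣p∣⇒Nonempty S (ℕ.≤-trans (s≤s z≤n) 2[1+k]≤∣S∣)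
    ... | i , i∈S =
      let 2k≤∣S′∣ = ℕ.≤-pred (ℕ.≤-pred (≡.subst₂ _≤_ (ℕ.*-suc 2 k) (∣deletePair∣ S-paired i∈S) 2[1+k]≤∣S∣))
          T , T⊆S′ , ∣T∣≡2k , ∑T≈k·a = paired-subset k (deletePair-paired S-paired i∈S) 2k≤∣S′∣
      in insertPair i T ,
         insertPair-⊆ S-paired i∈S T⊆S′ ,
         ≡.trans (∣insertPair∣ S-paired i∈S T⊆S′) (≡.trans (≡.cong (2 +_) ∣T∣≡2k) (≡.sym (ℕ.*-suc 2 k))) ,
         trans (∑-insertPair S-paired i∈S T⊆S′) (∙-congˡ ∑T≈k·a)

module ZeroSums {g ℓ} (G : AbelianGroup g ℓ) (_≟_ : Decidable (AbelianGroup._≈_ G))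
                {n} (fin : IsFiniteOfOrder G n) where
  open AbelianGroup G
  open IsFiniteOfOrder fin
  open SubsetSums G
  open import Algebra.Properties.AbelianGroup G
    using (∙-cancelˡ; ∙-cancelʳ; identityʳ-unique; ⁻¹-involutive; inverseʳ-unique; x∙y⁻¹≈ε⇒x≈y)
  open import Algebra.Properties.CommutativeSemigroup commutativeSemigroup using (interchange)
  open import Relation.Binary.Reasoning.Setoid setoid

  ZeroSum : ℕ → Set ℓ
  ZeroSum m = ∃ λ (S : Subset n) → ∣ S ∣ ≡ m × ∑ enum S ≈ ε

  index : Carrier → Fin n
  index x = proj₁ (surjective x)

  enum-index : ∀ x → enum (index x) ≈ x
  enum-index x = proj₂ (surjective x)

  enum-cong : ∀ {i j} → i ≡ j → enum i ≈ enum j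
  enum-cong = reflexive ∘ ≡.cong enum

  0ᵢ : Fin n
  0ᵢ = index ε

  T₂ : Subset n
  T₂ = twoTorsion G _≟_ fin

  ∈T₂⁺ : ∀ {i} → enum i ∙ enum i ≈ ε → i ∈ T₂
  ∈T₂⁺ {i} x∙x≈ε = lookup⇒[]= i T₂ (≡.trans (lookup∘tabulate _ i) (dec-true ((enum i ∙ enum i) ≟ ε) x∙x≈ε))

  ∈T₂⁻ : ∀ {i} → i ∈ T₂ → enum i ∙ enum i ≈ ε
  ∈T₂⁻ {i} i∈T₂ = from-does ((enum i ∙ enum i) ≟ ε) (≡.trans (≡.sym (lookup∘tabulate _ i)) ([]=⇒lookup i∈T₂))
    where
    from-does : (d : Dec (enum i ∙ enum i ≈ ε)) → does d ≡ inside → enum i ∙ enum i ≈ ε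
    from-does (yes x∙x≈ε) _ = x∙x≈ε

  0ᵢ∈T₂ : 0ᵢ ∈ T₂
  0ᵢ∈T₂ = ∈T₂⁺ (trans (∙-cong (enum-index ε) (enum-index ε)) (identityˡ ε))

  x∙y≈ε∧y∙y≈ε⇒x∙x≈ε : ∀ {x y} → x ∙ y ≈ ε → y ∙ y ≈ ε → x ∙ x ≈ ε
  x∙y≈ε∧y∙y≈ε⇒x∙x≈ε {x} {y} x∙y≈ε y∙y≈ε = begin
    x ∙ x             ≈⟨ sym (identityʳ _) ⟩
    (x ∙ x) ∙ ε       ≈⟨ ∙-congˡ (sym y∙y≈ε) ⟩
    (x ∙ x) ∙ (y ∙ y) ≈⟨ interchange _ _ _ _ ⟩
    (x ∙ y) ∙ (x ∙ y) ≈⟨ ∙-cong x∙y≈ε x∙y≈ε ⟩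
    ε ∙ ε             ≈⟨ identityˡ ε ⟩
    ε                 ∎

  shift : Carrier → Fin n → Fin n
  shift a i = index (enum i ∙ a)

  enum-shift : ∀ a i → enum (shift a i) ≈ enum i ∙ a
  enum-shift a i = enum-index (enum i ∙ a)

  shift-injective : ∀ a {i j} → shift a i ≡ shift a j → i ≡ j
  shift-injective a {i} {j} eq =
    injective i j (∙-cancelʳ a _ _ (trans (sym (enum-shift a i)) (trans (enum-cong eq) (enum-shift a j))))

  shift-involutive : ∀ {a} → a ∙ a ≈ ε → ∀ i → shift a (shift a i) ≡ i
  shift-involutive {a} a∙a≈ε i = injective _ _ (begin
    enum (shift a (shift a i)) ≈⟨ enum-shift a (shift a i) ⟩
    enum (shift a i) ∙ a       ≈⟨ ∙-congʳ (enum-shift a i) ⟩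
    (enum i ∙ a) ∙ a           ≈⟨ assoc _ _ _ ⟩
    enum i ∙ (a ∙ a)           ≈⟨ ∙-congˡ a∙a≈ε ⟩
    enum i ∙ ε                 ≈⟨ identityʳ _ ⟩
    enum i                     ∎)

  shift-fixed⇒≈ε : ∀ a i → shift a i ≡ i → a ≈ ε
  shift-fixed⇒≈ε a i eq = identityʳ-unique (enum i) a (trans (sym (enum-shift a i)) (enum-cong eq))

  shift-square : ∀ a i → enum (shift a i) ∙ enum (shift a i) ≈ (enum i ∙ enum i) ∙ (a ∙ a)
  shift-square a i = trans (∙-cong (enum-shift a i) (enum-shift a i)) (interchange _ _ _ _)

  enum∙enum-shift : ∀ a i → enum i ∙ enum i ≈ ε → enum i ∙ enum (shift a i) ≈ a
  enum∙enum-shift a i x∙x≈ε = begin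
    enum i ∙ enum (shift a i) ≈⟨ ∙-congˡ (enum-shift a i) ⟩
    enum i ∙ (enum i ∙ a)     ≈⟨ sym (assoc _ _ _) ⟩
    (enum i ∙ enum i) ∙ a     ≈⟨ ∙-congʳ x∙x≈ε ⟩
    ε ∙ a                     ≈⟨ identityˡ a ⟩
    a                         ∎

  neg : Fin n → Fin n
  neg i = index (enum i ⁻¹)

  enum-neg : ∀ i → enum (neg i) ≈ enum i ⁻¹
  enum-neg i = enum-index (enum i ⁻¹)

  neg-involutive : ∀ i → neg (neg i) ≡ i
  neg-involutive i = injective _ _ (trans (enum-neg (neg i)) (trans (⁻¹-cong (enum-neg i)) (⁻¹-involutive _)))

  module Negation = Pairing enum neg neg-involutive ε
  module Translation {a} (a∙a≈ε : a ∙ a ≈ ε) = Pairing enum (shift a) (shift-involutive a∙a≈ε) a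

  ∁T₂-paired : Negation.Paired (∁ T₂)
  ∁T₂-paired {i} i∈∁T₂ =
    x∉p⇒x∈∁p (i∉T₂ ∘ ∈T₂⁺ ∘ x∙y≈ε∧y∙y≈ε⇒x∙x≈ε x∙-x≈ε ∘ ∈T₂⁻) ,
    (λ neg-i≡i → i∉T₂ (∈T₂⁺ (trans (∙-congˡ (sym (enum-cong neg-i≡i))) x∙-x≈ε))) ,
    x∙-x≈ε
    where
    i∉T₂ = x∈∁p⇒x∉p i∈∁T₂
    x∙-x≈ε : enum i ∙ enum (neg i) ≈ ε
    x∙-x≈ε = trans (∙-congˡ (enum-neg i)) (inverseʳ _)

  T₂-paired : ∀ {a} (a∈T₂ : a ∈ T₂) → a ≢ 0ᵢ → Translation.Paired (∈T₂⁻ a∈T₂) T₂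
  T₂-paired {a} a∈T₂ a≢0ᵢ {i} i∈T₂ =
    ∈T₂⁺ (trans (shift-square (enum a) i) (trans (∙-cong (∈T₂⁻ i∈T₂) (∈T₂⁻ a∈T₂)) (identityˡ ε))) ,
    (λ fixed → a≢0ᵢ (injective a 0ᵢ (trans (shift-fixed⇒≈ε (enum a) i fixed) (sym (enum-index ε))))) ,
    enum∙enum-shift (enum a) i (∈T₂⁻ i∈T₂)

  total : Carrier
  total = ∑ enum ⊤

  ∑∁T₂≈ε : ∑ enum (∁ T₂) ≈ ε
  ∑∁T₂≈ε = let k , _ , ∑≈k·ε = Negation.paired-size-sum ∁T₂-paired in trans ∑≈k·ε (·-ε k)

  total≈∑T₂ : total ≈ ∑ enum T₂
  total≈∑T₂ = trans (sym (∑-∁ enum T₂)) (trans (∙-congˡ ∑∁T₂≈ε) (identityʳ _))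

  ∣T₂∣+∣∁T₂∣≡n : ∣ T₂ ∣ + ∣ ∁ T₂ ∣ ≡ n
  ∣T₂∣+∣∁T₂∣≡n = ≡.trans (≡.cong (∣ T₂ ∣ +_) (∣∁p∣≡n∸∣p∣ T₂)) (ℕ.m+[n∸m]≡n (∣p∣≤n T₂))

  ∣T₂∣≡2⇒total≉ε : ∣ T₂ ∣ ≡ 2 → ¬ total ≈ ε
  ∣T₂∣≡2⇒total≉ε ∣T₂∣≡2 total≈ε with ∑-of-size-2 enum T₂ ∣T₂∣≡2 0ᵢ∈T₂
  ... | j , j≢0ᵢ , ∑T₂≈0+j = j≢0ᵢ (injective j 0ᵢ (begin
    enum j           ≈⟨ sym (identityˡ _) ⟩
    ε ∙ enum j       ≈⟨ ∙-congʳ (sym (enum-index ε)) ⟩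
    enum 0ᵢ ∙ enum j ≈⟨ sym ∑T₂≈0+j ⟩
    ∑ enum T₂        ≈⟨ sym total≈∑T₂ ⟩
    total            ≈⟨ total≈ε ⟩
    ε                ≈⟨ sym (enum-index ε) ⟩
    enum 0ᵢ          ∎))

  -- k·x is ε for every x ∈ T₂ or x for every x ∈ T₂; two distinct choices of a exclude the latter.
  3≤∣T₂∣⇒total≈ε : 3 ≤ ∣ T₂ ∣ → total ≈ ε
  3≤∣T₂∣⇒total≈ε 3≤∣T₂∣ with twoOthers T₂ 0ᵢ∈T₂ 3≤∣T₂∣
  ... | a , b , a∈T₂ , b∈T₂ , a≢0ᵢ , b≢0ᵢ , b≢a
    with Translation.paired-size-sum (∈T₂⁻ a∈T₂) (T₂-paired a∈T₂ a≢0ᵢ)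
       | Translation.paired-size-sum (∈T₂⁻ b∈T₂) (T₂-paired b∈T₂ b≢0ᵢ)
  ... | k , ∣T₂∣≡2k , ∑≈k·a | k′ , ∣T₂∣≡2k′ , ∑≈k′·b
    rewrite ℕ.*-cancelˡ-≡ k′ k 2 (≡.trans (≡.sym ∣T₂∣≡2k′) ∣T₂∣≡2k) with ·-twoTorsion k
  ... | inj₁ k·x≈ε = trans total≈∑T₂ (trans ∑≈k·a (k·x≈ε (∈T₂⁻ a∈T₂)))
  ... | inj₂ k·x≈x = contradiction (injective b a (begin
    enum b      ≈⟨ sym (k·x≈x (∈T₂⁻ b∈T₂)) ⟩
    k · enum b  ≈⟨ sym ∑≈k′·b ⟩
    ∑ enum T₂   ≈⟨ ∑≈k·a ⟩
    k · enum a  ≈⟨ k·x≈x (∈T₂⁻ a∈T₂) ⟩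
    enum a      ∎)) b≢a

  zeroSum-∁ : total ≈ ε → ∀ {m} → ZeroSum m → ZeroSum (n ∸ m)
  zeroSum-∁ total≈ε (S , ∣S∣≡m , ∑S≈ε) = ∁ S , ≡.trans (∣∁p∣≡n∸∣p∣ S) (≡.cong (n ∸_) ∣S∣≡m) , (begin
    ∑ enum (∁ S)            ≈⟨ sym (identityˡ _) ⟩
    ε ∙ ∑ enum (∁ S)        ≈⟨ ∙-congʳ (sym ∑S≈ε) ⟩
    ∑ enum S ∙ ∑ enum (∁ S) ≈⟨ ∑-∁ enum S ⟩
    total                   ≈⟨ total≈ε ⟩
    ε                       ∎)

  zeroSum-small : ∀ m → m ≤ suc ∣ ∁ T₂ ∣ → ZeroSum m
  zeroSum-small m m≤1+∣∁T₂∣ with Negation.paired-size-sum ∁T₂-paired | even⊎odd m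
  ... | k , ∣∁T₂∣≡2k , _ | j , inj₁ m≡2j =
    let T , _ , ∣T∣≡2j , ∑T≈j·ε = Negation.paired-subset j ∁T₂-paired 2j≤∣∁T₂∣
    in T , ≡.trans ∣T∣≡2j (≡.sym m≡2j) , trans ∑T≈j·ε (·-ε j)
    where
    j≤k : j ≤ k
    j≤k = 2*j≤1+2*k⇒j≤k j k (≡.subst₂ (λ a b → a ≤ suc b) m≡2j ∣∁T₂∣≡2k m≤1+∣∁T₂∣)
    2j≤∣∁T₂∣ : 2 * j ≤ ∣ ∁ T₂ ∣
    2j≤∣∁T₂∣ = ℕ.≤-trans (ℕ.*-monoʳ-≤ 2 j≤k) (ℕ.≤-reflexive (≡.sym ∣∁T₂∣≡2k))
  ... | _ | j , inj₂ m≡1+2j =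
    let T , T⊆∁T₂ , ∣T∣≡2j , ∑T≈j·ε = Negation.paired-subset j ∁T₂-paired 2j≤∣∁T₂∣
        0ᵢ∉T : 0ᵢ ∉ T
        0ᵢ∉T 0ᵢ∈T = x∈∁p⇒x∉p (T⊆∁T₂ 0ᵢ∈T) 0ᵢ∈T₂
    in insert 0ᵢ T ,
       ≡.trans (∣insert∣ 0ᵢ T 0ᵢ∉T) (≡.trans (≡.cong suc ∣T∣≡2j) (≡.sym m≡1+2j)) ,
       trans (∑-insert enum 0ᵢ T 0ᵢ∉T) (trans (∙-cong (enum-index ε) (trans ∑T≈j·ε (·-ε j))) (identityˡ ε))
    where
    2j≤∣∁T₂∣ : 2 * j ≤ ∣ ∁ T₂ ∣
    2j≤∣∁T₂∣ = ℕ.≤-pred (≡.subst (_≤ suc ∣ ∁ T₂ ∣) m≡1+2j m≤1+∣∁T₂∣)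

  ∣T₂∣≤∣∁T₂∣ : 0 < ∣ ∁ T₂ ∣ → ∣ T₂ ∣ ≤ ∣ ∁ T₂ ∣
  ∣T₂∣≤∣∁T₂∣ 0<∣∁T₂∣ with 0<∣p∣⇒Nonempty (∁ T₂) 0<∣∁T₂∣
  ... | x , x∈∁T₂ = injection⇒∣p∣≤∣q∣ (shift (enum x)) (shift-injective (enum x)) shifted∈∁T₂
    where
    shifted∈∁T₂ : ∀ {i} → i ∈ T₂ → shift (enum x) i ∈ ∁ T₂
    shifted∈∁T₂ {i} i∈T₂ = x∉p⇒x∈∁p λ shifted∈T₂ → x∈∁p⇒x∉p x∈∁T₂ (∈T₂⁺ (begin
      enum x ∙ enum x                                   ≈⟨ sym (identityˡ _) ⟩
      ε ∙ (enum x ∙ enum x)                             ≈⟨ ∙-congʳ (sym (∈T₂⁻ i∈T₂)) ⟩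
      (enum i ∙ enum i) ∙ (enum x ∙ enum x)             ≈⟨ sym (shift-square (enum x) i) ⟩
      enum (shift (enum x) i) ∙ enum (shift (enum x) i) ≈⟨ ∈T₂⁻ shifted∈T₂ ⟩
      ε                                                 ∎))

  elementary⇒∣∁T₂∣≡0 : IsElementaryAbelian2 G → ∣ ∁ T₂ ∣ ≡ 0
  elementary⇒∣∁T₂∣≡0 elementary = ℕ.n≤0⇒n≡0 (ℕ.≤-trans (p⊆q⇒∣p∣≤∣q∣ ∁T₂⊆⊥) (ℕ.≤-reflexive (∣⊥∣≡0 n)))
    where
    ∁T₂⊆⊥ : ∁ T₂ ⊆ ⊥
    ∁T₂⊆⊥ i∈∁T₂ = contradiction (∈T₂⁺ (elementary _)) (x∈∁p⇒x∉p i∈∁T₂)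

  ∣∁T₂∣≡0⇒elementary : ∣ ∁ T₂ ∣ ≡ 0 → IsElementaryAbelian2 G
  ∣∁T₂∣≡0⇒elementary ∣∁T₂∣≡0 x = trans (∙-cong (sym (enum-index x)) (sym (enum-index x))) (∈T₂⁻ index-x∈T₂)
    where
    index-x∈T₂ : index x ∈ T₂
    index-x∈T₂ with index x ∈? T₂
    ... | yes ∈T₂ = ∈T₂
    ... | no  ∉T₂ = contradiction (≡.subst (index x ∈_) (∣p∣≡0⇒p≡⊥ (∁ T₂) ∣∁T₂∣≡0) (x∉p⇒x∈∁p ∉T₂)) ∉⊥

  -- If a subset of size k + 1 sums to 0, exchanging one of its elements b for an element c
  -- outside it changes the sum to c - b.
  nonzeroSum-ofSize : ∀ k → suc k < n → ∃ λ B → ∣ B ∣ ≡ suc k × ¬ ∑ enum B ≈ ε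
  nonzeroSum-ofSize k 1+k<n with subsetOfSize (suc k) (ℕ.<⇒≤ 1+k<n)
  ... | B , ∣B∣≡1+k with ∑ enum B ≟ ε
  ... | no  ∑B≉ε = B , ∣B∣≡1+k , ∑B≉ε
  ... | yes ∑B≈ε
    with 0<∣p∣⇒Nonempty B (≡.subst (0 <_) (≡.sym ∣B∣≡1+k) (s≤s z≤n))
       | ∣p∣<n⇒∃∉ B (≡.subst (_< n) (≡.sym ∣B∣≡1+k) 1+k<n)
  ... | b , b∈B | c , c∉B = insert c (delete b B) , ∣B′∣≡1+k , ∑B′≉ε
    where
    c∉B-b : c ∉ delete b B
    c∉B-b = c∉B ∘ proj₁ ∘ ∈delete⁻ b B
    ∣B′∣≡1+k : ∣ insert c (delete b B) ∣ ≡ suc k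
    ∣B′∣≡1+k = ≡.trans (∣insert∣ c (delete b B) c∉B-b) (≡.trans (≡.sym (∣delete∣ b B b∈B)) ∣B∣≡1+k)
    ∑B-b≈b⁻¹ : ∑ enum (delete b B) ≈ enum b ⁻¹
    ∑B-b≈b⁻¹ = inverseʳ-unique (enum b) _ (trans (sym (∑-delete enum b B b∈B)) ∑B≈ε)
    ∑B′≉ε : ¬ ∑ enum (insert c (delete b B)) ≈ ε
    ∑B′≉ε ∑B′≈ε = c∉B (≡.subst (_∈ B) (injective b c (sym c≈b)) b∈B)
      where
      c≈b : enum c ≈ enum b
      c≈b = x∙y⁻¹≈ε⇒x≈y _ _ (trans (∙-congˡ (sym ∑B-b≈b⁻¹)) (trans (sym (∑-insert enum c _ c∉B-b)) ∑B′≈ε))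

  module Elementary (elementary : IsElementaryAbelian2 G) where

    ¬zeroSum2 : ¬ ZeroSum 2
    ¬zeroSum2 (S , ∣S∣≡2 , ∑S≈ε) =
      let i , i∈S = 0<∣p∣⇒Nonempty S (≡.subst (0 <_) (≡.sym ∣S∣≡2) (s≤s z≤n))
          j , j≢i , ∑S≈i+j = ∑-of-size-2 enum S ∣S∣≡2 i∈S
      in j≢i (injective j i (∙-cancelˡ (enum i) _ _ (trans (sym ∑S≈i+j) (trans ∑S≈ε (sym (elementary _))))))

    -- A pair {a, a + s} outside B contributes 2a + s = s, cancelling s = ∑ B; the bound on ∣ B ∣
    -- leaves room for a outside both B and B - s.
    zeroSum-extend : ∀ B → ¬ ∑ enum B ≈ ε → ∣ B ∣ + ∣ B ∣ < n → ZeroSum (2 + ∣ B ∣)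
    zeroSum-extend B s≉ε 2∣B∣<n
      with ∣p∣<n⇒∃∉ (B ∪ preimage (shift (∑ enum B)) B)
             (ℕ.≤-<-trans (∣p∪preimage∣≤∣p∣+∣p∣ (shift (∑ enum B)) (shift-injective _) B) 2∣B∣<n)
    ... | a , a∉C = insert a (insert (shift s a) B) , ∣S∣≡2+∣B∣ , ∑S≈ε
      where
      s = ∑ enum B
      a∉B : a ∉ B
      a∉B = a∉C ∘ x∈p∪q⁺ ∘ inj₁
      sa∉B : shift s a ∉ B
      sa∉B = a∉C ∘ x∈p∪q⁺ ∘ inj₂ ∘ ∈preimage⁺ (shift s) B
      a∉sa∷B : a ∉ insert (shift s a) B
      a∉sa∷B = ∉insert (shift s a) B (λ a≡sa → s≉ε (shift-fixed⇒≈ε s a (≡.sym a≡sa))) a∉B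
      ∣S∣≡2+∣B∣ : ∣ insert a (insert (shift s a) B) ∣ ≡ 2 + ∣ B ∣
      ∣S∣≡2+∣B∣ = ≡.trans (∣insert∣ a _ a∉sa∷B) (≡.cong suc (∣insert∣ (shift s a) B sa∉B))
      ∑S≈ε : ∑ enum (insert a (insert (shift s a) B)) ≈ ε
      ∑S≈ε = begin
        ∑ enum (insert a (insert (shift s a) B)) ≈⟨ ∑-insert₂ enum a (shift s a) B sa∉B a∉sa∷B ⟩
        (enum a ∙ enum (shift s a)) ∙ s          ≈⟨ ∙-congʳ (enum∙enum-shift s a (elementary _)) ⟩
        s ∙ s                                    ≈⟨ elementary s ⟩
        ε                                        ∎

    zeroSum-≤half : ∀ m → 3 ≤ m → m ≤ n ∸ m → ZeroSum m
    zeroSum-≤half (suc (suc (suc k))) (s≤s (s≤s (s≤s z≤n))) m≤n-m =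
      let B , ∣B∣≡1+k , ∑B≉ε = nonzeroSum-ofSize k 1+k<n
      in ≡.subst (ZeroSum ∘ (2 +_)) ∣B∣≡1+k
           (zeroSum-extend B ∑B≉ε (≡.subst (λ b → b + b < n) (≡.sym ∣B∣≡1+k) 2[1+k]<n))
      where
      2[1+k]<n : suc k + suc k < n
      2[1+k]<n = ℕ.<-≤-trans (ℕ.+-mono-< 1+k<3+k 1+k<3+k) (m≤n∸m⇒m+m≤n m≤n-m)
        where 1+k<3+k = s≤s (ℕ.n≤1+n (suc k))
      1+k<n : suc k < n
      1+k<n = ℕ.≤-<-trans (ℕ.m≤m+n (suc k) (suc k)) 2[1+k]<n

    zeroSum-middle : total ≈ ε → ∀ {m} → m ≤ n → 3 ≤ m → 3 ≤ n ∸ m → ZeroSum m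
    zeroSum-middle total≈ε {m} m≤n 3≤m 3≤n-m with ℕ.≤-total m (n ∸ m)
    ... | inj₁ m≤n-m = zeroSum-≤half m 3≤m m≤n-m
    ... | inj₂ n-m≤m = ≡.subst ZeroSum n-[n-m]≡m (zeroSum-∁ total≈ε (zeroSum-≤half (n ∸ m) 3≤n-m n-m≤n-[n-m]))
      where
      n-[n-m]≡m = ℕ.m∸[m∸n]≡n m≤n
      n-m≤n-[n-m] = ≡.subst (n ∸ m ≤_) (≡.sym n-[n-m]≡m) n-m≤m

  Exception : ℕ → Set (g Level.⊔ ℓ)
  Exception m = (IsElementaryAbelian2 G × (m ≡ 2 ⊎ m ≡ n ∸ 2)) ⊎ (∣ T₂ ∣ ≡ 2 × m ≡ n)

  necessity : ∀ {m} → 1 ≤ m → ZeroSum m → ¬ Exception m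
  necessity _ zeroSum (inj₁ (elementary , inj₁ m≡2)) =
    Elementary.¬zeroSum2 elementary (≡.subst ZeroSum m≡2 zeroSum)
  necessity {m} 1≤m zeroSum (inj₁ (elementary , inj₂ m≡n-2)) =
    Elementary.¬zeroSum2 elementary (≡.subst ZeroSum n-m≡2 (zeroSum-∁ total≈ε zeroSum))
    where
    3≤n = 1≤n∸2⇒3≤n n (≡.subst (1 ≤_) m≡n-2 1≤m)
    ∣T₂∣≡n : ∣ T₂ ∣ ≡ n
    ∣T₂∣≡n = ≡.trans (≡.sym (ℕ.+-identityʳ _))
               (≡.trans (≡.cong (∣ T₂ ∣ +_) (≡.sym (elementary⇒∣∁T₂∣≡0 elementary))) ∣T₂∣+∣∁T₂∣≡n)
    total≈ε = 3≤∣T₂∣⇒total≈ε (≡.subst (3 ≤_) (≡.sym ∣T₂∣≡n) 3≤n)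
    n-m≡2 : n ∸ m ≡ 2
    n-m≡2 = ≡.trans (≡.cong (n ∸_) m≡n-2) (ℕ.m∸[m∸n]≡n (ℕ.≤-trans (s≤s (s≤s z≤n)) 3≤n))
  necessity _ (S , ∣S∣≡m , ∑S≈ε) (inj₂ (∣T₂∣≡2 , m≡n)) =
    ∣T₂∣≡2⇒total≉ε ∣T₂∣≡2 (≡.subst (λ S → ∑ enum S ≈ ε) (∣p∣≡n⇒p≡⊤ {p = S} (≡.trans ∣S∣≡m m≡n)) ∑S≈ε)

  large⇒3≤∣T₂∣ : ∀ {m} → m ≤ n → suc ∣ ∁ T₂ ∣ < m → ¬ (∣ T₂ ∣ ≡ 2 × m ≡ n) → 3 ≤ ∣ T₂ ∣
  large⇒3≤∣T₂∣ {m} m≤n 1+∣∁T₂∣<m not-exception with 3 ℕ.≤? ∣ T₂ ∣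
  ... | yes 3≤∣T₂∣ = 3≤∣T₂∣
  ... | no  3≰∣T₂∣ = contradiction (∣T₂∣≡2 , ℕ.≤-antisym m≤n n≤m) not-exception
    where
    2≤∣T₂∣ : 2 ≤ ∣ T₂ ∣
    2≤∣T₂∣ = ℕ.+-cancelʳ-≤ (∣ ∁ T₂ ∣) 2 (∣ T₂ ∣)
               (ℕ.≤-trans (ℕ.≤-trans 1+∣∁T₂∣<m m≤n) (ℕ.≤-reflexive (≡.sym ∣T₂∣+∣∁T₂∣≡n)))
    ∣T₂∣≡2 : ∣ T₂ ∣ ≡ 2
    ∣T₂∣≡2 = ℕ.≤-antisym (ℕ.≤-pred (ℕ.≰⇒> 3≰∣T₂∣)) 2≤∣T₂∣
    n≤m : n ≤ m
    n≤m = ℕ.≤-trans (ℕ.≤-reflexive (≡.trans (≡.sym ∣T₂∣+∣∁T₂∣≡n) (≡.cong (_+ ∣ ∁ T₂ ∣) ∣T₂∣≡2))) 1+∣∁T₂∣<m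

  both-large⇒∣∁T₂∣≡0 : ∀ {m} → m ≤ n → suc ∣ ∁ T₂ ∣ < m → suc ∣ ∁ T₂ ∣ < n ∸ m → ∣ ∁ T₂ ∣ ≡ 0
  both-large⇒∣∁T₂∣≡0 m≤n 1+∣∁T₂∣<m 1+∣∁T₂∣<n-m with ∣ ∁ T₂ ∣ ℕ.≟ 0
  ... | yes ∣∁T₂∣≡0 = ∣∁T₂∣≡0
  ... | no  ∣∁T₂∣≢0 = contradiction n<n (ℕ.<-irrefl ≡.refl)
    where
    n<n : n < n
    n<n = ℕ.≤-<-trans
      (ℕ.≤-trans (ℕ.≤-reflexive (≡.sym ∣T₂∣+∣∁T₂∣≡n)) (ℕ.+-monoˡ-≤ _ (∣T₂∣≤∣∁T₂∣ (ℕ.n≢0⇒n>0 ∣∁T₂∣≢0))))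
      (a<m∧b<n∸m⇒a+b<n m≤n (ℕ.<⇒≤ 1+∣∁T₂∣<m) (ℕ.<⇒≤ 1+∣∁T₂∣<n-m))

  sufficiency : ∀ {m} → m ≤ n → ¬ Exception m → ZeroSum m
  sufficiency {m} m≤n not-exception with m ℕ.≤? suc ∣ ∁ T₂ ∣
  ... | yes m≤1+∣∁T₂∣ = zeroSum-small m m≤1+∣∁T₂∣
  ... | no  m≰1+∣∁T₂∣ = large (n ∸ m ℕ.≤? suc ∣ ∁ T₂ ∣)
    where
    1+∣∁T₂∣<m = ℕ.≰⇒> m≰1+∣∁T₂∣
    total≈ε = 3≤∣T₂∣⇒total≈ε (large⇒3≤∣T₂∣ m≤n 1+∣∁T₂∣<m (not-exception ∘ inj₂))
    large : Dec (n ∸ m ≤ suc ∣ ∁ T₂ ∣) → ZeroSum m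
    large (yes n-m≤1+∣∁T₂∣) =
      ≡.subst ZeroSum (ℕ.m∸[m∸n]≡n m≤n) (zeroSum-∁ total≈ε (zeroSum-small (n ∸ m) n-m≤1+∣∁T₂∣))
    large (no  n-m≰1+∣∁T₂∣) = Elementary.zeroSum-middle elementary total≈ε m≤n 3≤m 3≤n-m
      where
      ∣∁T₂∣≡0 = both-large⇒∣∁T₂∣≡0 m≤n 1+∣∁T₂∣<m (ℕ.≰⇒> n-m≰1+∣∁T₂∣)
      elementary = ∣∁T₂∣≡0⇒elementary ∣∁T₂∣≡0
      3≤m : 3 ≤ m
      3≤m = ℕ.≤∧≢⇒< (≡.subst (λ l → suc l < m) ∣∁T₂∣≡0 1+∣∁T₂∣<m)
                    (λ 2≡m → not-exception (inj₁ (elementary , inj₁ (≡.sym 2≡m))))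
      3≤n-m : 3 ≤ n ∸ m
      3≤n-m = ℕ.≤∧≢⇒< (≡.subst (λ l → suc l < n ∸ m) ∣∁T₂∣≡0 (ℕ.≰⇒> n-m≰1+∣∁T₂∣))
                      (λ 2≡n-m → not-exception (inj₁ (elementary , inj₂
                        (≡.trans (≡.sym (ℕ.m∸[m∸n]≡n m≤n)) (≡.cong (n ∸_) (≡.sym 2≡n-m))))))

corollary3p4 : ∀ {c ℓ} (G : AbelianGroup c ℓ) (dec : Decidable (AbelianGroup._≈_ G))
    (n : ℕ) (fin : IsFiniteOfOrder G n) → 2 ≤ n →
    (m : ℕ) → 1 ≤ m → m ≤ n →
    (Σ (Subset n) (λ S → ∣ S ∣ ≡ m × AbelianGroup._≈_ G (subsetSum G (IsFiniteOfOrder.enum fin) S) (AbelianGroup.ε G)))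
    ⇔ (¬ ((IsElementaryAbelian2 G × (m ≡ 2 ⊎ m ≡ n ∸ 2)) ⊎ (twoTorsionOrder G dec fin ≡ 2 × m ≡ n)))
corollary3p4 G dec n fin _ m 1≤m m≤n = mk⇔ (necessity 1≤m) (sufficiency m≤n)
  where open ZeroSums G dec fin
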